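{- Let $K$ be an algebraically closed field of characteristic $0$. It is not true that for all integers $n\ge1$ and $d\ge2$ there exists a constant $B(n,d)$ such that $\#\mathcal{L}^n_{\varphi_d,P}\le B(n,d)$ for every point $P\in\mathbb{P}^n(K)$ none of whose coordinates is zero; here $\varphi_d([z_0,\ldots,z_n])=[z_0^d,\ldots,z_n^d]$. (That is, without the hypothesis $\mathcal{R}(P)=\{\mathbf{0}\}$, no bound on $\#\mathcal{L}^n_{\varphi_d,P}$ depending only on $n$ and $d$ exists.)
   Context: $\mathcal{R}(P)=\{(e_0,\ldots,e_n)\in\mathbb{Z}^{n+1}:\sum_ie_i=0,\ \prod_i\alpha_i^{e_i}=1\}$ for $P=[\alpha_0,\ldots,\alpha_n]$. $\mathcal{O}_{\varphi}(P)=\{\varphi^m(P):m\ge0\}$. $\mathcal{L}^n_{\varphi,P}$ is the set of hyperplanes $H\subset\mathbb{P}^n$ such that $H\cap\mathcal{O}_\varphi(P)$ contains $n+1$ points any $n$ of which span $H$. -}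

module Defs where

open import Level using (Level)
open import Algebra.Bundles using (CommutativeRing)
open import Data.Nat using (ℕ; zero; suc)
open import Data.Fin using (Fin; zero; suc; punchIn)
open import Data.Product using (Σ; ∃; _×_; _,_)
open import Data.List using (List)
open import Relation.Nullary using (¬_)
open import Relation.Binary.PropositionalEquality using (_≡_)

module _ {c ℓ : Level} (R : CommutativeRing c ℓ) where
  open CommutativeRing R using (Carrier; _≈_; _+_; _*_; 0#; 1#)

  pow : Carrier → ℕ → Carrier
  pow x zero    = 1#
  pow x (suc k) = x * pow x k

  sumK : ∀ {n} → (Fin n → Carrier) → Carrier
  sumK {zero}  f = 0#
  sumK {suc n} f = f zero + sumK (λ i → f (suc i))

  natK : ℕ → Carrier
  natK zero    = 0#
  natK (suc k) = 1# + natK k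

  IsField : Set (c Level.⊔ ℓ)
  IsField = (¬ (1# ≈ 0#)) × (∀ x → ¬ (x ≈ 0#) → ∃ λ y → x * y ≈ 1#)

  CharZero : Set ℓ
  CharZero = ∀ k → ¬ (natK (suc k) ≈ 0#)

  AlgClosed : Set (c Level.⊔ ℓ)
  AlgClosed = ∀ k (a : Fin (suc k) → Carrier) →
    ∃ λ x → pow x (suc k) + sumK (λ i → a i * pow x (Data.Fin.toℕ i)) ≈ 0#

  -- vectors in K^{n+1} (homogeneous coordinates on P^n); linear forms likewise
  Vect : ℕ → Set c
  Vect n = Fin (suc n) → Carrier

  NonzeroVec : ∀ {n} → Vect n → Set ℓ
  NonzeroVec v = ∃ λ i → ¬ (v i ≈ 0#)

  AllCoordsNonzero : ∀ {n} → Vect n → Set ℓ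
  AllCoordsNonzero v = ∀ i → ¬ (v i ≈ 0#)

  -- v and w represent the same point of P^n (resp. the same hyperplane)
  Proportional : ∀ {n} → Vect n → Vect n → Set (c Level.⊔ ℓ)
  Proportional v w = ∃ λ t → (¬ (t ≈ 0#)) × (∀ i → v i ≈ t * w i)

  φ : ∀ {n} → ℕ → Vect n → Vect n
  φ d v i = pow (v i) d

  iter : ∀ {n} → ℕ → ℕ → Vect n → Vect n
  iter d zero    v = v
  iter d (suc m) v = φ d (iter d m v)

  OnHyp : ∀ {n} → Vect n → Vect n → Set ℓ
  OnHyp a z = sumK (λ i → a i * z i) ≈ 0#

  Spans : ∀ {n} → (Fin n → Vect n) → Vect n → Set (c Level.⊔ ℓ)
  Spans Q a = (∀ i → OnHyp a (Q i)) ×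
    (∀ w → OnHyp a w → ∃ λ (t : Fin _ → Carrier) → ∀ k → w k ≈ sumK (λ i → t i * Q i k))

  -- H_a ∈ 𝓛^n_{φ_d,P}: a is a nonzero linear form and H_a ∩ O_{φ_d}(P) contains
  -- n+1 distinct points φ_d^{m_0}(P), …, φ_d^{m_n}(P), any n of which span H_a
  InL : ∀ {n} → ℕ → Vect n → Vect n → Set (c Level.⊔ ℓ)
  InL {n} d P a = NonzeroVec a × (∃ λ (m : Fin (suc n) → ℕ) →
      (∀ i j → ¬ (i ≡ j) → ¬ Proportional (iter d (m i) P) (iter d (m j) P))
    × (∀ i → OnHyp a (iter d (m i) P))
    × (∀ j → Spans (λ i → iter d (m (punchIn j i)) P) a))

module Submission where

open import Defs
open import Level using (Level)
open import Algebra.Bundles using (CommutativeRing)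
open import Data.Nat using (ℕ; zero; suc; _≤_; s≤s; z≤n; _!; NonZero)
import Data.Nat as Nat
import Data.Nat.Properties as Natₚ
open import Data.Nat.Divisibility using (_∣_; ∣-trans; m∣m*n; ∣m+n∣m⇒∣n; ∣1⇒≡1; m≤n⇒m!∣n!)
open import Data.Nat.Primality using (Prime; prime⇒nonZero; prime⇒nonTrivial)
open import Data.Nat.Primality.Factorisation using (factorise)
open import Data.Nat.ListAction using (product)
open import Data.Product using (∃; ∃₂; _×_; _,_; proj₁; proj₂)
open import Data.Fin using (Fin; zero; suc; toℕ; punchIn)
open import Data.Fin.Properties using (toℕ-injective; toℕ<n; punchIn-injective; 0≢1+n)
open import Data.List using (List; []; _∷_; length; tabulate)
open import Data.List.Properties using (length-tabulate)
import Data.List.Relation.Unary.All.Properties as All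
import Data.List.Relation.Unary.AllPairs.Properties as AllPairs
open import Data.List.Relation.Unary.All using (All; _∷_)
open import Data.List.Relation.Unary.AllPairs using (AllPairs)
open import Relation.Nullary using (¬_; yes; no)
import Relation.Binary.PropositionalEquality as ≡
open ≡ using (_≡_; _≢_)
open import Data.Empty using (⊥-elim)
open import Data.Nat.Coprimality using (coprime-Bézout; prime⇒coprime)
open import Data.Nat.GCD using (module Bézout)
open import Relation.Binary using (tri<; tri≈; tri>)

-- We refute the bound already for
-- n = d = 2 by an explicit configuration, following the paper.
--
-- Fix a prime p and a root of unity ζ of order 2^p - 1 with ζ ≠ 1; then ζ has
-- exact period p under squaring.  For P = [1 : 2 : ζ] the orbit is
-- φ₂^m(P) = [1 : 2^(2^m) : ζ^(2^m)]: in characteristic 0 the orbit points are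
-- pairwise distinct, while the last coordinate is p-periodic.  So for j < p the
-- line z₂ = ζ^(2^j)·z₀ contains the three orbit points j, j + p, j + 2p, any two
-- of which span it, and the p lines are pairwise distinct.  Taking p > B
-- contradicts any bound B.

module Arithmetic where
  open Nat using (_<_; _^_)
  open Natₚ using (suc-injective; ≰⇒>; +-comm; _!≢0; <-cmp; <-irrefl; ^-monoʳ-<)

  ^-injectiveʳ : ∀ b → 1 < b → ∀ {m n} → b ^ m ≡ b ^ n → m ≡ n
  ^-injectiveʳ b 1<b {m} {n} bᵐ≡bⁿ with <-cmp m n
  ... | tri< m<n _ _ = ⊥-elim (<-irrefl bᵐ≡bⁿ (^-monoʳ-< b 1<b m<n))
  ... | tri≈ _ m≡n _ = m≡n
  ... | tri> _ _ n<m = ⊥-elim (<-irrefl (≡.sym bᵐ≡bⁿ) (^-monoʳ-< b 1<b n<m))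

  ∣-factorial : ∀ q {n} → .{{NonZero q}} → q ≤ n → q ∣ n !
  ∣-factorial (suc q) q≤n = ∣-trans (m∣m*n (q !)) (m≤n⇒m!∣n! q≤n)

  -- Euclid: there are primes beyond every bound.  A prime factor q of B! + 1
  -- cannot be ≤ B, for then q would divide both B! and B! + 1.
  prime-above : ∀ B → ∃ λ p → Prime p × B < p
  prime-above B with factorise (suc (B !))
  ... | record { factors = [] ; isFactorisation = B!+1≡1 } =
    ⊥-elim (Nat.≢-nonZero⁻¹ (B !) {{B !≢0}} (suc-injective B!+1≡1))
  ... | record { factors = q ∷ qs ; isFactorisation = eq ; factorsPrime = q-prime ∷ _ } =
    q , q-prime , B<q
    where
    q∣B!+1 : q ∣ suc (B !)
    q∣B!+1 = ≡.subst (q ∣_) (≡.sym eq) (m∣m*n (product qs))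
    B<q : B < q
    B<q with q Nat.≤? B
    ... | no q≰B = ≰⇒> q≰B
    ... | yes q≤B = ⊥-elim (Nat.nonTrivial⇒≢1 {{prime⇒nonTrivial q-prime}} q≡1)
      where
      q≡1 : q ≡ 1
      q≡1 = ∣1⇒≡1 (∣m+n∣m⇒∣n (≡.subst (q ∣_) (+-comm 1 (B !)) q∣B!+1)
                             (∣-factorial q {{prime⇒nonZero q-prime}} q≤B))

pattern i₀ = zero
pattern i₁ = suc zero
pattern i₂ = suc (suc zero)

module Algebraic {c ℓ : Level} (K : CommutativeRing c ℓ) where
  open CommutativeRing K hiding (zero)
  open import Relation.Binary.Reasoning.Setoid setoid
  open import Algebra.Properties.Semiring.Exp semiring using (_^_; ^-congˡ; ^-assocʳ)
  open import Algebra.Properties.Semiring.Mult semiring using (×1-homo-*) renaming (_×_ to _×ᴿ_)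
  open import Algebra.Properties.Monoid.Mult *-monoid using (×-idem)
  open import Algebra.Properties.Group +-group
    using (∙-cancelˡ; //-rightDividesˡ; x∙y⁻¹≈ε⇒x≈y; x≈y⇒x∙y⁻¹≈ε; ⁻¹-injective)
  open import Algebra.Properties.Ring ring using (-‿distribˡ-*)
  open import Algebra.Solver.Ring.NaturalCoefficients.Default commutativeSemiring
  open Arithmetic using (^-injectiveʳ)

  pow≡^ : ∀ x n → pow K x n ≡ x ^ n
  pow≡^ x zero    = ≡.refl
  pow≡^ x (suc n) = ≡.cong (x *_) (pow≡^ x n)

  natK≡× : ∀ n → natK K n ≡ n ×ᴿ 1#
  natK≡× zero    = ≡.refl
  natK≡× (suc n) = ≡.cong (1# +_) (natK≡× n)

  natK-* : ∀ m n → natK K (m Nat.* n) ≈ natK K m * natK K n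
  natK-* m n rewrite natK≡× (m Nat.* n) | natK≡× m | natK≡× n = ×1-homo-* m n

  natK-^ : ∀ m n → natK K (m Nat.^ n) ≈ natK K m ^ n
  natK-^ m zero    = +-identityʳ 1#
  natK-^ m (suc n) = trans (natK-* m (m Nat.^ n)) (*-congˡ (natK-^ m n))

  natK-injective : CharZero K → ∀ m n → natK K m ≈ natK K n → m ≡ n
  natK-injective char0 zero    zero    _ = ≡.refl
  natK-injective char0 zero    (suc n) e = ⊥-elim (char0 n (sym e))
  natK-injective char0 (suc m) zero    e = ⊥-elim (char0 m e)
  natK-injective char0 (suc m) (suc n) e =
    ≡.cong suc (natK-injective char0 m n (∙-cancelˡ 1# (natK K m) (natK K n) e))

  1^n≈1 : ∀ n → 1# ^ n ≈ 1#
  1^n≈1 zero    = refl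
  1^n≈1 (suc n) = trans (*-identityˡ _) (1^n≈1 n)

  iter-coord : ∀ {n} d m (v : Vect K n) i → iter K d m v i ≈ v i ^ (d Nat.^ m)
  iter-coord d zero    v i = sym (*-identityʳ (v i))
  iter-coord d (suc m) v i = begin
    pow K (iter K d m v i) d     ≡⟨ pow≡^ _ d ⟩
    iter K d m v i ^ d           ≈⟨ ^-congˡ d (iter-coord d m v i) ⟩
    (v i ^ (d Nat.^ m)) ^ d      ≈⟨ ^-assocʳ (v i) (d Nat.^ m) d ⟩
    v i ^ (d Nat.^ m Nat.* d)    ≡⟨ ≡.cong (v i ^_) (Natₚ.*-comm (d Nat.^ m) d) ⟩
    v i ^ (d Nat.^ suc m)        ∎

  -- The set of such e
  -- is closed under addition, so with Bézout a prime period p together with a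
  -- shorter return time e forces x^d ≈ x; hence x, x^d, …, x^(d^(p-1)) are distinct.
  module PowerOrbit (d : ℕ) (x : Carrier) where

    Returns : ℕ → Set ℓ
    Returns e = x ^ (d Nat.^ e) ≈ x

    orbit-+ : ∀ a b → x ^ (d Nat.^ (b Nat.+ a)) ≈ (x ^ (d Nat.^ a)) ^ (d Nat.^ b)
    orbit-+ a b = begin
      x ^ (d Nat.^ (b Nat.+ a))            ≡⟨ ≡.cong (x ^_) (Natₚ.^-distribˡ-+-* d b a) ⟩
      x ^ (d Nat.^ b Nat.* d Nat.^ a)      ≡⟨ ≡.cong (x ^_) (Natₚ.*-comm (d Nat.^ b) (d Nat.^ a)) ⟩
      x ^ (d Nat.^ a Nat.* d Nat.^ b)      ≈⟨ ^-assocʳ x (d Nat.^ a) (d Nat.^ b) ⟨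
      (x ^ (d Nat.^ a)) ^ (d Nat.^ b)      ∎

    returns-shift : ∀ {a} → Returns a → ∀ b → x ^ (d Nat.^ (b Nat.+ a)) ≈ x ^ (d Nat.^ b)
    returns-shift {a} ret b = trans (orbit-+ a b) (^-congˡ (d Nat.^ b) ret)

    returns-* : ∀ {a} → Returns a → ∀ q → Returns (q Nat.* a)
    returns-* ret zero    = *-identityʳ x
    returns-* {a} ret (suc q) = trans (returns-shift (returns-* ret q) a) ret

    consecutive-returns : ∀ {a b} → Returns a → Returns b → suc a ≡ b → x ^ d ≈ x
    consecutive-returns {a} {b} ret-a ret-b 1+a≡b = begin
      x ^ d                          ≡⟨ ≡.cong (x ^_) (Natₚ.*-identityʳ d) ⟨
      x ^ (d Nat.^ 1)                ≈⟨ returns-shift {a} ret-a 1 ⟨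
      x ^ (d Nat.^ (1 Nat.+ a))      ≡⟨ ≡.cong (λ k → x ^ (d Nat.^ k)) 1+a≡b ⟩
      x ^ (d Nat.^ b)                ≈⟨ ret-b ⟩
      x                              ∎

    prime-period : ∀ {p e} → Prime p → Returns p → Returns e → 0 Nat.< e → e Nat.< p → x ^ d ≈ x
    prime-period p-prime ret-p ret-e 0<e e<p
      with coprime-Bézout (prime⇒coprime p-prime {{Nat.>-nonZero 0<e}} e<p)
    ... | Bézout.+- q r 1+re≡qp = consecutive-returns (returns-* ret-e r) (returns-* ret-p q) 1+re≡qp
    ... | Bézout.-+ q r 1+qp≡re = consecutive-returns (returns-* ret-p q) (returns-* ret-e r) 1+qp≡re

    -- within a prime period p the first p points of the orbit are distinct
    -- (if x^(d^i) ≈ x^(d^j) with i < j < p, then p - j + i is a return time)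
    orbit-injective< : ∀ {p} → Prime p → Returns p → ¬ x ^ d ≈ x →
                       ∀ {i j} → i Nat.< j → j Nat.< p → ¬ x ^ (d Nat.^ i) ≈ x ^ (d Nat.^ j)
    orbit-injective< {p} p-prime ret-p moves {i} {j} i<j j<p xᵢ≈xⱼ =
      moves (prime-period p-prime ret-p ret 0<r+i r+i<p)
      where
      r = p Nat.∸ j
      r+j≡p : r Nat.+ j ≡ p
      r+j≡p = Natₚ.m∸n+n≡m (Natₚ.<⇒≤ j<p)
      0<r+i : 0 Nat.< r Nat.+ i
      0<r+i = Natₚ.<-≤-trans (Natₚ.m<n⇒0<n∸m j<p) (Natₚ.m≤m+n r i)
      r+i<p : r Nat.+ i Nat.< p
      r+i<p = ≡.subst (r Nat.+ i Nat.<_) r+j≡p (Natₚ.+-monoʳ-< r i<j)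
      ret : Returns (r Nat.+ i)
      ret = begin
        x ^ (d Nat.^ (r Nat.+ i))            ≈⟨ orbit-+ i r ⟩
        (x ^ (d Nat.^ i)) ^ (d Nat.^ r)      ≈⟨ ^-congˡ (d Nat.^ r) xᵢ≈xⱼ ⟩
        (x ^ (d Nat.^ j)) ^ (d Nat.^ r)      ≈⟨ orbit-+ j r ⟨
        x ^ (d Nat.^ (r Nat.+ j))            ≡⟨ ≡.cong (λ k → x ^ (d Nat.^ k)) r+j≡p ⟩
        x ^ (d Nat.^ p)                      ≈⟨ ret-p ⟩
        x                                    ∎

    orbit-injective : ∀ {p} → Prime p → Returns p → ¬ x ^ d ≈ x →
                      ∀ {i j} → i Nat.< p → j Nat.< p → x ^ (d Nat.^ i) ≈ x ^ (d Nat.^ j) → i ≡ j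
    orbit-injective p-prime ret-p moves {i} {j} i<p j<p xᵢ≈xⱼ with Natₚ.<-cmp i j
    ... | tri< i<j _ _ = ⊥-elim (orbit-injective< p-prime ret-p moves i<j j<p xᵢ≈xⱼ)
    ... | tri≈ _ i≡j _ = i≡j
    ... | tri> _ _ j<i = ⊥-elim (orbit-injective< p-prime ret-p moves j<i i<p (sym xᵢ≈xⱼ))

  sumK-factor : ∀ {n} x (f g : Fin n → Carrier) → (∀ i → f i ≈ x * g i) → sumK K f ≈ x * sumK K g
  sumK-factor {zero}  x f g _ = sym (zeroʳ x)
  sumK-factor {suc n} x f g f≈xg =
    trans (+-cong (f≈xg zero) (sumK-factor x _ _ (λ i → f≈xg (suc i)))) (sym (distribˡ x _ _))

  -- The geometric sum 1 + x + … + x^(n-1), written as in the definition of AlgClosed.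
  geometric : ℕ → Carrier → Carrier
  geometric n x = sumK K {n} (λ i → 1# * pow K x (toℕ i))

  geometric-suc : ∀ n x → geometric (suc n) x ≈ 1# + x * geometric n x
  geometric-suc n x = +-cong (*-identityˡ 1#) (sumK-factor {n} x _ _ λ i →
    trans (*-identityˡ _) (*-congˡ (sym (*-identityˡ _))))

  geometric-telescope : ∀ n x → x * geometric n x + 1# ≈ geometric n x + pow K x n
  geometric-telescope zero    x = solve 1 (λ x → x :* con 0 :+ con 1 := con 0 :+ con 1) refl x
  geometric-telescope (suc n) x = begin
    x * G′ + 1#                  ≈⟨ +-congʳ (*-congˡ (geometric-suc n x)) ⟩
    x * (1# + x * G) + 1#        ≈⟨ solve 2 (λ x G → x :* (con 1 :+ x :* G) :+ con 1 := x :* (x :* G :+ con 1) :+ con 1) refl x G ⟩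
    x * (x * G + 1#) + 1#        ≈⟨ +-congʳ (*-congˡ (geometric-telescope n x)) ⟩
    x * (G + pow K x n) + 1#     ≈⟨ solve 3 (λ x G A → x :* (G :+ A) :+ con 1 := (con 1 :+ x :* G) :+ x :* A) refl x G (pow K x n) ⟩
    (1# + x * G) + x * pow K x n ≈⟨ +-congʳ (geometric-suc n x) ⟨
    G′ + pow K x (suc n)         ∎
    where
    G = geometric n x
    G′ = geometric (suc n) x

  geometric-at-1 : ∀ n {x} → x ≈ 1# → geometric n x ≈ natK K n
  geometric-at-1 zero    x≈1 = refl
  geometric-at-1 (suc n) x≈1 = trans (geometric-suc n _)
    (+-congˡ (trans (*-cong x≈1 (geometric-at-1 n x≈1)) (*-identityˡ _)))

  -- An algebraically closed field of characteristic 0 has a (k+2)-th root of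
  -- unity other than 1, namely a root of 1 + x + … + x^(k+1).
  root-of-unity : CharZero K → AlgClosed K → ∀ k → ∃ λ ζ → ζ ^ suc (suc k) ≈ 1# × ¬ ζ ≈ 1#
  root-of-unity char0 closed k = ζ , ζᵏ⁺²≈1 , ζ≉1
    where
    ζ = proj₁ (closed k (λ _ → 1#))
    A = pow K ζ (suc k)
    G = geometric (suc k) ζ
    root : A + G ≈ 0#
    root = proj₂ (closed k (λ _ → 1#))
    ζᵏ⁺²≈1 : ζ ^ suc (suc k) ≈ 1#
    ζᵏ⁺²≈1 = begin
      ζ ^ suc (suc k)          ≡⟨ pow≡^ ζ (suc (suc k)) ⟨
      ζ * A                    ≈⟨ +-identityʳ (ζ * A) ⟨
      ζ * A + 0#               ≈⟨ +-congˡ (trans (sym root) (+-comm A G)) ⟩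
      ζ * A + (G + A)          ≈⟨ +-congˡ (geometric-telescope (suc k) ζ) ⟨
      ζ * A + (ζ * G + 1#)     ≈⟨ solve 3 (λ z A G → z :* A :+ (z :* G :+ con 1) := z :* (A :+ G) :+ con 1) refl ζ A G ⟩
      ζ * (A + G) + 1#         ≈⟨ +-congʳ (*-congˡ root) ⟩
      ζ * 0# + 1#              ≈⟨ solve 1 (λ z → z :* con 0 :+ con 1 := con 1) refl ζ ⟩
      1#                       ∎
    ζ≉1 : ¬ ζ ≈ 1#
    ζ≉1 ζ≈1 = char0 (suc k) (begin
      1# + natK K (suc k)      ≈⟨ +-cong (sym (1^n≈1 (suc k))) (sym (geometric-at-1 (suc k) ζ≈1)) ⟩
      1# ^ suc k + G           ≈⟨ +-congʳ (^-congˡ (suc k) ζ≈1) ⟨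
      ζ ^ suc k + G            ≡⟨ ≡.cong (_+ G) (pow≡^ ζ (suc k)) ⟨
      A + G                    ≈⟨ root ⟩
      0#                       ∎)

  -- For p ≥ 2 there is ζ with ζ^(2^p) ≈ ζ and ζ² ≉ ζ (a nontrivial (2^p - 1)-th
  -- root of unity): a point of period dividing p, but not fixed, under squaring.
  squaring-cycle : CharZero K → AlgClosed K → ∀ p → 2 Nat.≤ p →
                   ∃ λ ζ → ζ ^ (2 Nat.^ p) ≈ ζ × ¬ ζ ^ 2 ≈ ζ
  squaring-cycle char0 closed p 2≤p = ζ , cycle , moves
    where
    k = 2 Nat.^ p Nat.∸ 3
    unity = root-of-unity char0 closed k
    ζ : Carrier
    ζ = proj₁ unity
    ζᵏ⁺²≈1 : ζ ^ suc (suc k) ≈ 1#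
    ζᵏ⁺²≈1 = proj₁ (proj₂ unity)
    2ᵖ≡k+3 : 2 Nat.^ p ≡ suc (suc (suc k))
    2ᵖ≡k+3 = ≡.sym (Natₚ.m+[n∸m]≡n (Natₚ.≤-trans (Natₚ.n≤1+n 3) (Natₚ.^-monoʳ-≤ 2 2≤p)))
    cycle : ζ ^ (2 Nat.^ p) ≈ ζ
    cycle = begin
      ζ ^ (2 Nat.^ p)        ≡⟨ ≡.cong (ζ ^_) 2ᵖ≡k+3 ⟩
      ζ * ζ ^ suc (suc k)    ≈⟨ *-congˡ ζᵏ⁺²≈1 ⟩
      ζ * 1#                 ≈⟨ *-identityʳ ζ ⟩
      ζ                      ∎
    -- if ζ² ≈ ζ then every positive power of ζ is ζ, so ζ ≈ ζ^(k+2) ≈ 1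
    moves : ¬ ζ ^ 2 ≈ ζ
    moves ζ²≈ζ = proj₂ (proj₂ unity)
      (trans (sym (×-idem (trans (*-congˡ (sym (*-identityʳ ζ))) ζ²≈ζ) (suc (suc k)))) ζᵏ⁺²≈1)

  interpolate : IsField K → ∀ {u v} → ¬ u ≈ v → ∀ a b →
                ∃₂ λ t₀ t₁ → t₀ + t₁ ≈ a × t₀ * u + t₁ * v ≈ b
  interpolate fld {u} {v} u≉v a b = t₀ , t₁ , sum-eq , weighted-eq
    where
    δ = v - u
    δ≉0 : ¬ δ ≈ 0#
    δ≉0 δ≈0 = u≉v (sym (x∙y⁻¹≈ε⇒x≈y v u δ≈0))
    δ⁻¹ = proj₁ (proj₂ fld δ δ≉0)
    t₁ = (b - a * u) * δ⁻¹
    t₀ = a - t₁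
    sum-eq : t₀ + t₁ ≈ a
    sum-eq = //-rightDividesˡ t₁ a
    t₁δ≈b-au : t₁ * δ ≈ b - a * u
    t₁δ≈b-au = begin
      (b - a * u) * δ⁻¹ * δ      ≈⟨ *-assoc _ δ⁻¹ δ ⟩
      (b - a * u) * (δ⁻¹ * δ)    ≈⟨ *-congˡ (trans (*-comm δ⁻¹ δ) (proj₂ (proj₂ fld δ δ≉0))) ⟩
      (b - a * u) * 1#           ≈⟨ *-identityʳ _ ⟩
      b - a * u                  ∎
    weighted-eq : t₀ * u + t₁ * v ≈ b
    weighted-eq = begin
      t₀ * u + t₁ * v            ≈⟨ +-congˡ (*-congˡ (//-rightDividesˡ u v)) ⟨
      t₀ * u + t₁ * (δ + u)      ≈⟨ solve 4 (λ t₀ t₁ δ u → t₀ :* u :+ t₁ :* (δ :+ u) := (t₀ :+ t₁) :* u :+ t₁ :* δ) refl t₀ t₁ δ u ⟩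
      (t₀ + t₁) * u + t₁ * δ     ≈⟨ +-cong (*-congʳ sum-eq) t₁δ≈b-au ⟩
      a * u + (b - a * u)        ≈⟨ +-comm _ _ ⟩
      (b - a * u) + a * u        ≈⟨ //-rightDividesˡ (a * u) b ⟩
      b                          ∎

  proportional-normalised : ∀ {n} {v w : Vect K n} i → Proportional K v w →
                            v i ≈ 1# → w i ≈ 1# → ∀ j → v j ≈ w j
  proportional-normalised i (t , _ , v≈tw) vᵢ≈1 wᵢ≈1 j =
    trans (v≈tw j) (trans (*-congʳ t≈1) (*-identityˡ _))
    where
    t≈1 : t ≈ 1#
    t≈1 = trans (sym (*-identityʳ t)) (trans (*-congˡ (sym wᵢ≈1)) (trans (sym (v≈tw i)) vᵢ≈1))

  sumK-pair : (f : Fin 2 → Carrier) → sumK K f ≈ f zero + f (suc zero)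
  sumK-pair f = +-congˡ (+-identityʳ _)

  line : Carrier → Vect K 2
  line c i₀ = - c
  line c i₁ = 0#
  line c i₂ = 1#

  line-form : ∀ c (v : Vect K 2) → sumK K (λ i → line c i * v i) ≈ v i₂ - c * v i₀
  line-form c v = begin
    - c * v i₀ + (0# * v i₁ + (1# * v i₂ + 0#))      ≈⟨ +-congʳ (-‿distribˡ-* c (v i₀)) ⟨
    - (c * v i₀) + (0# * v i₁ + (1# * v i₂ + 0#))    ≈⟨ solve 3 (λ m v₁ v₂ → m :+ (con 0 :* v₁ :+ (con 1 :* v₂ :+ con 0)) := v₂ :+ m) refl (- (c * v i₀)) (v i₁) (v i₂) ⟩
    v i₂ - c * v i₀                                  ∎

  on-line : ∀ {c} v → v i₂ ≈ c * v i₀ → OnHyp K (line c) v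
  on-line {c} v v₂≈cv₀ = trans (line-form c v) (x≈y⇒x∙y⁻¹≈ε v₂≈cv₀)

  on-line⁻¹ : ∀ {c} v → OnHyp K (line c) v → v i₂ ≈ c * v i₀
  on-line⁻¹ {c} v on = x∙y⁻¹≈ε⇒x≈y _ _ (trans (sym (line-form c v)) on)

  on-line′ : ∀ {c} v → v i₀ ≈ 1# → v i₂ ≈ c → OnHyp K (line c) v
  on-line′ {c} v v₀≈1 v₂≈c =
    on-line v (trans v₂≈c (trans (sym (*-identityʳ c)) (*-congˡ (sym v₀≈1))))

  line-spanned : IsField K → ∀ {c} (Q : Fin 2 → Vect K 2) →
                 (∀ i → Q i i₀ ≈ 1#) → (∀ i → Q i i₂ ≈ c) →
                 ¬ Q zero i₁ ≈ Q (suc zero) i₁ → Spans K Q (line c)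
  line-spanned fld {c} Q Q₀≈1 Q₂≈c Q₁-distinct = (λ i → on-line′ (Q i) (Q₀≈1 i) (Q₂≈c i)) , spanned
    where
    spanned : ∀ w → OnHyp K (line c) w → ∃ λ t → ∀ k → w k ≈ sumK K (λ i → t i * Q i k)
    spanned w w-on = t , λ k → trans (coord k) (sym (sumK-pair (λ i → t i * Q i k)))
      where
      coefficients = interpolate fld Q₁-distinct (w i₀) (w i₁)
      t₀ t₁ : Carrier
      t₀ = proj₁ coefficients
      t₁ = proj₁ (proj₂ coefficients)
      sum-eq : t₀ + t₁ ≈ w i₀
      sum-eq = proj₁ (proj₂ (proj₂ coefficients))
      weighted-eq : t₀ * Q zero i₁ + t₁ * Q (suc zero) i₁ ≈ w i₁
      weighted-eq = proj₂ (proj₂ (proj₂ coefficients))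
      t : Fin 2 → Carrier
      t zero       = t₀
      t (suc zero) = t₁
      coord : ∀ k → w k ≈ t₀ * Q zero k + t₁ * Q (suc zero) k
      coord i₀ = begin
        w i₀                  ≈⟨ sum-eq ⟨
        t₀ + t₁               ≈⟨ +-cong (*-identityʳ t₀) (*-identityʳ t₁) ⟨
        t₀ * 1# + t₁ * 1#     ≈⟨ +-cong (*-congˡ (Q₀≈1 zero)) (*-congˡ (Q₀≈1 (suc zero))) ⟨
        t₀ * Q zero i₀ + t₁ * Q (suc zero) i₀ ∎
      coord i₁ = sym weighted-eq
      coord i₂ = begin
        w i₂                  ≈⟨ on-line⁻¹ w w-on ⟩
        c * w i₀              ≈⟨ *-congˡ sum-eq ⟨
        c * (t₀ + t₁)         ≈⟨ solve 3 (λ c t₀ t₁ → c :* (t₀ :+ t₁) := t₀ :* c :+ t₁ :* c) refl c t₀ t₁ ⟩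
        t₀ * c + t₁ * c       ≈⟨ +-cong (*-congˡ (Q₂≈c zero)) (*-congˡ (Q₂≈c (suc zero))) ⟨
        t₀ * Q zero i₂ + t₁ * Q (suc zero) i₂ ∎

  line-injective : ∀ {a b} → Proportional K (line a) (line b) → a ≈ b
  line-injective prop = ⁻¹-injective (proportional-normalised i₂ prop refl refl i₀)

  module Configuration (fld : IsField K) (char0 : CharZero K)
                       {p : ℕ} (p-prime : Prime p) (ζ : Carrier)
                       (ζ-cycle : ζ ^ (2 Nat.^ p) ≈ ζ) (ζ-moves : ¬ ζ ^ 2 ≈ ζ) where
    open PowerOrbit 2 ζ using (returns-shift; returns-*; orbit-injective)

    P : Vect K 2
    P i₀ = 1#
    P i₁ = natK K 2
    P i₂ = ζ

    P-nonzero : AllCoordsNonzero K P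
    P-nonzero i₀ = proj₁ fld
    P-nonzero i₁ = char0 1
    P-nonzero i₂ ζ≈0 = ζ-moves (begin
      ζ ^ 2          ≈⟨ ^-congˡ 2 ζ≈0 ⟩
      0# * (0# * 1#) ≈⟨ zeroˡ _ ⟩
      0#             ≈⟨ ζ≈0 ⟨
      ζ              ∎)

    orbit : ℕ → Vect K 2
    orbit m = iter K 2 m P

    orbit₀ : ∀ m → orbit m i₀ ≈ 1#
    orbit₀ m = trans (iter-coord 2 m P i₀) (1^n≈1 (2 Nat.^ m))

    orbit₁ : ∀ m → orbit m i₁ ≈ natK K (2 Nat.^ (2 Nat.^ m))
    orbit₁ m = trans (iter-coord 2 m P i₁) (sym (natK-^ 2 (2 Nat.^ m)))

    orbit₁-injective : ∀ {m m′} → orbit m i₁ ≈ orbit m′ i₁ → m ≡ m′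
    orbit₁-injective {m} {m′} e =
      ^-injectiveʳ 2 (Natₚ.n<1+n 1) (^-injectiveʳ 2 (Natₚ.n<1+n 1)
        (natK-injective char0 _ _ (trans (sym (orbit₁ m)) (trans e (orbit₁ m′)))))

    orbit-distinct : ∀ {m m′} → m ≢ m′ → ¬ Proportional K (orbit m) (orbit m′)
    orbit-distinct {m} {m′} m≢m′ prop =
      m≢m′ (orbit₁-injective (proportional-normalised i₀ prop (orbit₀ m) (orbit₀ m′) i₁))

    -- the line z₂ = ζ^(2^j)·z₀; it only depends on j modulo p
    L : ℕ → Vect K 2
    L j = line (ζ ^ (2 Nat.^ j))

    hits : ℕ → Fin 3 → ℕ
    hits j i = j Nat.+ toℕ i Nat.* p

    hits-injective : ∀ j {a b} → hits j a ≡ hits j b → a ≡ b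
    hits-injective j {a} {b} e = toℕ-injective
      (Natₚ.*-cancelʳ-≡ (toℕ a) (toℕ b) p {{prime⇒nonZero p-prime}} (Natₚ.+-cancelˡ-≡ j _ _ e))

    orbit₂-hits : ∀ j i → orbit (hits j i) i₂ ≈ ζ ^ (2 Nat.^ j)
    orbit₂-hits j i = trans (iter-coord 2 (hits j i) P i₂) (returns-shift (returns-* ζ-cycle (toℕ i)) j)

    L-in-𝓛 : ∀ j → InL K 2 P (L j)
    L-in-𝓛 j = (i₂ , proj₁ fld) , hits j , distinct , on , spans
      where
      distinct : ∀ a b → a ≢ b → ¬ Proportional K (orbit (hits j a)) (orbit (hits j b))
      distinct a b a≢b = orbit-distinct (λ e → a≢b (hits-injective j e))
      on : ∀ i → OnHyp K (L j) (orbit (hits j i))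
      on i = on-line′ (orbit (hits j i)) (orbit₀ (hits j i)) (orbit₂-hits j i)
      -- dropping the k-th of the three points leaves two distinct points of L j
      spans : ∀ k → Spans K (λ i → orbit (hits j (punchIn k i))) (L j)
      spans k = line-spanned fld (λ i → orbit (index i)) (λ i → orbit₀ (index i))
        (λ i → orbit₂-hits j (punchIn k i))
        (λ e → 0≢1+n (punchIn-injective k zero (suc zero)
                        (hits-injective j (orbit₁-injective {index zero} {index (suc zero)} e))))
        where
        index : Fin 2 → ℕ
        index i = hits j (punchIn k i)

    L-distinct : ∀ (a b : Fin p) → a ≢ b → ¬ Proportional K (L (toℕ a)) (L (toℕ b))
    L-distinct a b a≢b prop = a≢b (toℕ-injective
      (orbit-injective p-prime ζ-cycle ζ-moves (toℕ<n a) (toℕ<n b) (line-injective prop)))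

    lines : List (Vect K 2)
    lines = tabulate (λ (a : Fin p) → L (toℕ a))

    length-lines : length lines ≡ p
    length-lines = length-tabulate _

    lines-in-𝓛 : All (InL K 2 P) lines
    lines-in-𝓛 = All.tabulate⁺ (λ a → L-in-𝓛 (toℕ a))

    lines-distinct : AllPairs (λ a b → ¬ Proportional K a b) lines
    lines-distinct = AllPairs.tabulate⁺ (L-distinct _ _)

corollary6p2 : ∀ {c ℓ : Level} (K : CommutativeRing c ℓ) →
    IsField K → CharZero K → AlgClosed K →
    ¬ (∀ (n d : ℕ) → 1 ≤ n → 2 ≤ d → ∃ λ (B : ℕ) →
        ∀ (P : Vect K n) → AllCoordsNonzero K P →
        ∀ (Hs : List (Vect K n)) → All (InL K d P) Hs →
        AllPairs (λ a b → ¬ Proportional K a b) Hs → length Hs ≤ B)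
corollary6p2 K fld char0 closed bounded =
  Natₚ.<⇒≱ B<p (≡.subst (_≤ B) length-lines (bound P P-nonzero lines lines-in-𝓛 lines-distinct))
  where
  bounded-2-2 = bounded 2 2 (s≤s z≤n) (s≤s (s≤s z≤n))
  B = proj₁ bounded-2-2
  bound = proj₂ bounded-2-2
  large-prime = Arithmetic.prime-above B
  p = proj₁ large-prime
  p-prime = proj₁ (proj₂ large-prime)
  B<p = proj₂ (proj₂ large-prime)
  cycle = Algebraic.squaring-cycle K char0 closed p (Nat.nonTrivial⇒n>1 p {{prime⇒nonTrivial p-prime}})
  open Algebraic.Configuration K fld char0 p-prime (proj₁ cycle) (proj₁ (proj₂ cycle)) (proj₂ (proj₂ cycle))
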